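{- Let $q\ge 1$, $n\ge 0$ and $k$ with $1\le k\le q$ be integers. Let $a_1,\dots,a_n\in\mathbb{Z}_q$ be reduced residues (i.e. $\gcd(a_i,q)=1$ for all $i$), and let $P\subseteq\mathbb{Z}_q$ with $|P|=k$. Then the number of the $2^n$ choices $(\varepsilon_1,\dots,\varepsilon_n)\in\{0,1\}^n$ for which $\sum_{i=1}^n\varepsilon_i a_i \in P$ (computed in $\mathbb{Z}_q$) is at most $$\sum_{\substack{j\in\mathbb{Z}\\ (n-k)/2\le j<(n+k)/2}}\binom{n}{j}_q .$$ Moreover this bound is best possible: for every such $q,n,k$ there exist reduced residues $a_1,\dots,a_n$ and a set $P\subseteq\mathbb{Z}_q$ with $|P|=k$ for which equality holds.
   Context: $\mathbb{Z}_q$ denotes the integers modulo $q$. For integers $n\ge 0$ and $s$, the mod $q$ binomial coefficient is $\binom{n}{s}_q=|\{A\subseteq\{1,\dots,n\}: |A|\equiv s \pmod q\}|=\sum_{j\equiv s \pmod q}\binom{n}{j}$ (sum over integers $j$ with $0\le j\le n$). -}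

module Defs where

open import Data.Bool using (Bool; true; false; if_then_else_)
open import Data.Nat using (ℕ; zero; suc; _+_; _*_; NonZero)
open import Data.Nat.DivMod using (_mod_)
open import Data.Nat.Combinatorics using (_C_)
open import Data.Integer as ℤ using (ℤ; +_; -_)
open import Data.Integer.DivMod using (_%ℕ_)
open import Data.Fin using (Fin; toℕ)
open import Data.Fin.Subset using (Subset)
open import Data.Fin.Subset.Properties using (_∈?_)
open import Data.Vec using (Vec; []; _∷_; lookup)
open import Data.List using (List; []; _∷_; map; filter; length; upTo; _++_)
open import Data.Nat.ListAction using (sum)
open import Data.Nat.Properties using (_≟_)
open import Relation.Nullary using (¬_; yes; no)
open import Relation.Nullary.Decidable using (_×-dec_)
open import Data.Product using (_×_)

allChoices : (n : ℕ) → List (Vec Bool n)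
allChoices zero    = [] ∷ []
allChoices (suc n) = map (false ∷_) (allChoices n) ++ map (true ∷_) (allChoices n)

weightedSum : ∀ {n q} → Vec (Fin q) n → Vec Bool n → ℕ
weightedSum []       []       = 0
weightedSum (a ∷ as) (e ∷ es) = (if e then toℕ a else 0) + weightedSum as es

sumModq : ∀ {n} (q : ℕ) .{{_ : NonZero q}} → Vec (Fin q) n → Vec Bool n → Fin q
sumModq q a ε = weightedSum a ε mod q

hitCount : ∀ {n} (q : ℕ) .{{_ : NonZero q}} → Vec (Fin q) n → Subset q → ℕ
hitCount {n} q a P = length (filter (λ ε → sumModq q a ε ∈? P) (allChoices n))

-- Mod q binomial coefficient: binom(n, s)_q = ∑_{0 ≤ j ≤ n, j ≡ s (mod q)} C(n, j), for s ∈ ℤ.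
binomMod : (q : ℕ) .{{_ : NonZero q}} → ℕ → ℤ → ℕ
binomMod q n s =
  sum (map (λ j → n C j) (filter (λ j → ((+ j) %ℕ q) ≟ (s %ℕ q)) (upTo (suc n))))

-- Candidate integers -k, -k+1, …, n+k (this contains every integer j with
-- (n-k)/2 ≤ j < (n+k)/2 when k ≥ 0).
candidates : ℕ → ℕ → List ℤ
candidates n k = map (λ t → (- (+ k)) ℤ.+ (+ t)) (upTo (suc (n + (k + k))))

window : ℕ → ℕ → List ℤ
window n k = filter (λ j → ((+ n) ℤ.- (+ k) ℤ.≤? (+ 2) ℤ.* j) ×-dec ((+ 2) ℤ.* j ℤ.<? (+ n) ℤ.+ (+ k)))
                    (candidates n k)

bound : (q : ℕ) .{{_ : NonZero q}} → ℕ → ℕ → ℕ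
bound q n k = sum (map (binomMod q n) (window n k))

-- Let hits a g count the ε with ∑ εᵢ aᵢ ∈ g. Splitting on ε₁ gives
-- hits (a₁ ∷ a) g = hits a g + hits a (g − a₁), and replacing the pair g, g − a₁ by their
-- union and intersection keeps the sum of indicators pointwise, hence the count. Since a₁
-- is a unit and 0 < |g| < q, g is not invariant under translation by a₁, so the
-- intersection has fewer than k points; moving points of the union into the intersection
-- one at a time (again keeping the pointwise sum) yields sets of sizes k + 1 and k − 1, and
-- induction on n closes with bound(n + 1, k) = bound(n, k + 1) + bound(n, k − 1), a
-- consequence of Pascal's rule for the mod q binomials. For equality take all aᵢ = 1: then
-- ∑ εᵢ aᵢ is the number of ones of ε, the count for an arc of k consecutive residues is a sum
-- of mod q binomials over k consecutive integers, and the window is such a run.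

module Submission where

open import Defs
open import Data.Nat using (ℕ; NonZero; _≤_)
open import Data.Nat.Coprimality using (Coprime)
open import Data.Fin using (Fin; toℕ)
open import Data.Fin.Subset using (Subset; ∣_∣)
open import Data.Fin.Subset.Properties using (_∈?_)
open import Data.Vec using (Vec; lookup)
open import Data.Product using (_×_; Σ)
open import Relation.Binary.PropositionalEquality using (_≡_)

open import Data.Bool using (Bool; true; false; _∧_; _∨_; not; if_then_else_)
open import Data.Fin using (zero; suc; _≟_; fromℕ<)
import Data.Fin.Properties as Fin
open import Data.Fin.Permutation using (permutation)
open import Data.Integer as ℤ using (ℤ; _%ℕ_)
open import Data.Integer.DivMod using (a≡a%ℕn+[a/ℕn]*n; n%ℕd<d)
import Data.Integer.Properties as ℤP
import Data.Integer.Tactic.RingSolver as ℤ-Ring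
open import Data.List using (List; []; _∷_; _++_; map; filter; length; applyUpTo)
open import Data.List.Properties
  using (map-cong; map-∘; map-++; map-applyUpTo; filter-++; filter-all; filter-none; ++-identityʳ)
open import Data.List.Relation.Unary.All using (All; []; _∷_)
open import Data.Nat using (zero; suc; _+_; _*_; _∸_; _<_; z≤n; s≤s; s≤s⁻¹; >-nonZero⁻¹; ⌊_/2⌋; ⌈_/2⌉)
open import Data.Nat.Combinatorics using (_C_; nCk+nC[k+1]≡[n+1]C[k+1]; k>n⇒nCk≡0)
import Data.Nat.Coprimality as Coprimality
open import Data.Nat.Coprimality using (coprime-Bézout)
open import Data.Nat.DivMod using (_mod_)
open import Data.Nat.GCD using (module Bézout)
open import Data.Nat.GeneralisedArithmetic using (fold)
open import Data.Nat.ListAction using (sum)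
open import Data.Nat.ListAction.Properties using (sum-++)
import Data.Nat.Properties as ℕ
open import Data.Nat.Tactic.RingSolver using (solve-∀)
open import Data.Product using (_,_; proj₁; proj₂; ∃) renaming (map to map-Σ)
open import Data.Product.Function.NonDependent.Propositional using (_×-⇔_)
open import Data.Sum using (inj₁; inj₂)
open import Data.Vec using ([]; _∷_; replicate; tabulate)
open import Data.Vec.Properties using (lookup-replicate; lookup∘tabulate)
open import Function using (_∘_; id; case_of_)
open import Function.Bundles using (_⇔_; mk⇔; Equivalence)
open import Function.Properties.Equivalence using () renaming (trans to ⇔-trans; sym to ⇔-sym)
open import Relation.Binary.Bundles using (Setoid)
open import Relation.Binary.PropositionalEquality
  using (_≢_; refl; sym; trans; cong; cong₂; subst; subst₂; module ≡-Reasoning)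
import Relation.Binary.Reasoning.Setoid as SetoidReasoning
open import Relation.Nullary using (Dec; yes; no; does; ¬_; contradiction)
open import Relation.Nullary.Decidable using (does-⇔; dec-true; dec-false; _×-dec_)
open import Algebra.Properties.CommutativeMonoid.Sum ℕ.+-0-commutativeMonoid
  using (∑-distrib-+; sum-cong-≗; sum-permute; sum-syntax) renaming (sum to ∑)

𝟙 : Bool → ℕ
𝟙 true  = 1
𝟙 false = 0

𝟙≤1 : ∀ b → 𝟙 b ≤ 1
𝟙≤1 true  = ℕ.≤-refl
𝟙≤1 false = z≤n

∧-not-split : ∀ a b → 𝟙 a ≡ 𝟙 (a ∧ b) + 𝟙 (a ∧ not b)
∧-not-split true  true  = refl
∧-not-split true  false = refl
∧-not-split false _     = refl

∨-∧-balanced : ∀ a b → 𝟙 a + 𝟙 b ≡ 𝟙 (a ∨ b) + 𝟙 (a ∧ b)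
∨-∧-balanced true  true  = refl
∨-∧-balanced true  false = refl
∨-∧-balanced false true  = refl
∨-∧-balanced false false = refl

module _ {A : Set} where

  Splits : (f g h : A → Bool) → Set
  Splits f g h = ∀ x → 𝟙 (f x) ≡ 𝟙 (g x) + 𝟙 (h x)

  Balanced : (f g u v : A → Bool) → Set
  Balanced f g u v = ∀ x → 𝟙 (f x) + 𝟙 (g x) ≡ 𝟙 (u x) + 𝟙 (v x)

  count : (A → Bool) → List A → ℕ
  count f xs = sum (map (𝟙 ∘ f) xs)

  sum-map-+ : ∀ (f g : A → ℕ) xs → sum (map (λ x → f x + g x) xs) ≡ sum (map f xs) + sum (map g xs)
  sum-map-+ f g []       = refl
  sum-map-+ f g (x ∷ xs) = trans (cong ((f x + g x) +_) (sum-map-+ f g xs)) (interchange (f x) (g x) _ _)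
    where
    interchange : ∀ a b c d → (a + b) + (c + d) ≡ (a + c) + (b + d)
    interchange = solve-∀

  count-cong : ∀ {f g} → (∀ x → f x ≡ g x) → ∀ xs → count f xs ≡ count g xs
  count-cong f≗g xs = cong sum (map-cong (cong 𝟙 ∘ f≗g) xs)

  count-split : ∀ {f g h} → Splits f g h → ∀ xs → count f xs ≡ count g xs + count h xs
  count-split {f} {g} {h} split xs =
    trans (cong sum (map-cong split xs)) (sum-map-+ (𝟙 ∘ g) (𝟙 ∘ h) xs)

  count-balanced : ∀ {f g u v} → Balanced f g u v → ∀ xs → count f xs + count g xs ≡ count u xs + count v xs
  count-balanced {f} {g} {u} {v} bal xs = begin
    count f xs + count g xs                  ≡⟨ sum-map-+ (𝟙 ∘ f) (𝟙 ∘ g) xs ⟨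
    sum (map (λ x → 𝟙 (f x) + 𝟙 (g x)) xs)   ≡⟨ cong sum (map-cong bal xs) ⟩
    sum (map (λ x → 𝟙 (u x) + 𝟙 (v x)) xs)   ≡⟨ sum-map-+ (𝟙 ∘ u) (𝟙 ∘ v) xs ⟩
    count u xs + count v xs                  ∎
    where open ≡-Reasoning

  count-++ : ∀ f xs ys → count f (xs ++ ys) ≡ count f xs + count f ys
  count-++ f xs ys = trans (cong sum (map-++ (𝟙 ∘ f) xs ys)) (sum-++ (map (𝟙 ∘ f) xs) _)

  count-≤-length : ∀ f xs → count f xs ≤ length xs
  count-≤-length f []       = z≤n
  count-≤-length f (x ∷ xs) with f x
  ... | true  = s≤s (count-≤-length f xs)
  ... | false = ℕ.m≤n⇒m≤1+n (count-≤-length f xs)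

  count-none : ∀ {f} → (∀ x → f x ≡ false) → ∀ xs → count f xs ≡ 0
  count-none none []       = refl
  count-none none (x ∷ xs) rewrite none x = count-none none xs

  count-all : ∀ {f} → (∀ x → f x ≡ true) → ∀ xs → count f xs ≡ length xs
  count-all all []       = refl
  count-all all (x ∷ xs) rewrite all x = cong suc (count-all all xs)

  length-filter-count : ∀ {P : A → Set} (P? : ∀ x → Dec (P x)) xs →
                        length (filter P? xs) ≡ count (does ∘ P?) xs
  length-filter-count P? []       = refl
  length-filter-count P? (x ∷ xs) with does (P? x)
  ... | true  = cong suc (length-filter-count P? xs)
  ... | false = length-filter-count P? xs

count-map : ∀ {A B : Set} (f : B → Bool) (h : A → B) xs → count f (map h xs) ≡ count (f ∘ h) xs
count-map f h xs = cong sum (sym (map-∘ xs))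

∑-last : ∀ {N} (f : ℕ → ℕ) → ∑[ i < suc N ] f (toℕ i) ≡ ∑[ i < N ] f (toℕ i) + f N
∑-last {zero}  f = ℕ.+-comm (f 0) 0
∑-last {suc N} f = trans (cong (f 0 +_) (∑-last (f ∘ suc))) (sym (ℕ.+-assoc (f 0) _ _))

sum-filter : ∀ {P : ℕ → Set} (P? : ∀ i → Dec (P i)) (g h : ℕ → ℕ) N →
             sum (map g (filter P? (applyUpTo h N))) ≡ ∑[ i < N ] (if does (P? (h (toℕ i))) then g (h (toℕ i)) else 0)
sum-filter P? g h zero    = refl
sum-filter P? g h (suc N) with does (P? (h 0))
... | true  = cong (g (h 0) +_) (sum-filter P? g (h ∘ suc) N)
... | false = sum-filter P? g (h ∘ suc) N

module _ {n : ℕ} where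

  size : (Fin n → Bool) → ℕ
  size g = ∑ (𝟙 ∘ g)

  singleton : Fin n → Fin n → Bool
  singleton x y = does (y ≟ x)

  size-split : ∀ {f g h} → Splits f g h → size f ≡ size g + size h
  size-split {f} {g} {h} split = trans (sum-cong-≗ split) (∑-distrib-+ (𝟙 ∘ g) (𝟙 ∘ h))

  size-balanced : ∀ {f g u v} → Balanced f g u v → size f + size g ≡ size u + size v
  size-balanced {f} {g} {u} {v} bal = begin
    size f + size g            ≡⟨ ∑-distrib-+ (𝟙 ∘ f) (𝟙 ∘ g) ⟨
    ∑ (λ x → 𝟙 (f x) + 𝟙 (g x)) ≡⟨ sum-cong-≗ bal ⟩
    ∑ (λ x → 𝟙 (u x) + 𝟙 (v x)) ≡⟨ ∑-distrib-+ (𝟙 ∘ u) (𝟙 ∘ v) ⟩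
    size u + size v            ∎
    where open ≡-Reasoning

  size-permute : ∀ g (π π⁻¹ : Fin n → Fin n) → (∀ y → π (π⁻¹ y) ≡ y) → (∀ y → π⁻¹ (π y) ≡ y) →
                 size (g ∘ π) ≡ size g
  size-permute g π π⁻¹ inv₁ inv₂ = sym (sum-permute (𝟙 ∘ g) (permutation π π⁻¹ inv₁ inv₂))

size-cong : ∀ {n} {f g : Fin n → Bool} → (∀ x → f x ≡ g x) → size f ≡ size g
size-cong f≗g = sum-cong-≗ (cong 𝟙 ∘ f≗g)

size-empty : ∀ {n} → size {n} (λ _ → false) ≡ 0
size-empty {zero}  = refl
size-empty {suc n} = size-empty {n}

size-full : ∀ {n} → size {n} (λ _ → true) ≡ n
size-full {zero}  = refl
size-full {suc n} = cong suc (size-full {n})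

size-≤ : ∀ {n} (g : Fin n → Bool) → size g ≤ n
size-≤ {zero}  g = z≤n
size-≤ {suc n} g with g zero
... | true  = s≤s (size-≤ (g ∘ suc))
... | false = ℕ.m≤n⇒m≤1+n (size-≤ (g ∘ suc))

size≡0⇒empty : ∀ {n} (g : Fin n → Bool) → size g ≡ 0 → ∀ x → g x ≡ false
size≡0⇒empty {suc n} g ∣g∣≡0 x with g zero in eq
size≡0⇒empty {suc n} g ∣g∣≡0 zero    | false = eq
size≡0⇒empty {suc n} g ∣g∣≡0 (suc x) | false = size≡0⇒empty (g ∘ suc) ∣g∣≡0 x

size≡n⇒full : ∀ {n} (g : Fin n → Bool) → size g ≡ n → ∀ x → g x ≡ true
size≡n⇒full {suc n} g ∣g∣≡n x with g zero in eq
size≡n⇒full {suc n} g ∣g∣≡n zero    | true  = eq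
size≡n⇒full {suc n} g ∣g∣≡n (suc x) | true  = size≡n⇒full (g ∘ suc) (ℕ.suc-injective ∣g∣≡n) x
size≡n⇒full {suc n} g ∣g∣≡n x       | false =
  contradiction (subst (_≤ n) ∣g∣≡n (size-≤ (g ∘ suc))) (ℕ.<-irrefl refl)

size-singleton : ∀ {n} (x : Fin n) → size (singleton x) ≡ 1
size-singleton {suc n} zero    = cong suc (size-empty {n})
size-singleton {suc n} (suc x) = size-singleton x

size-outside : ∀ {n} (f g : Fin n → Bool) → size g < size f → ∃ λ x → f x ≡ true × g x ≡ false
size-outside {suc n} f g ∣g∣<∣f∣ with f zero in ef | g zero in eg
... | true  | false = zero , ef , eg
... | true  | true  = map-Σ suc id (size-outside (f ∘ suc) (g ∘ suc) (s≤s⁻¹ ∣g∣<∣f∣))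
... | false | false = map-Σ suc id (size-outside (f ∘ suc) (g ∘ suc) ∣g∣<∣f∣)
... | false | true  = map-Σ suc id (size-outside (f ∘ suc) (g ∘ suc) (ℕ.<⇒≤ ∣g∣<∣f∣))

nonempty : ∀ {n} (g : Fin n → Bool) → 0 < size g → ∃ λ x → g x ≡ true
nonempty {n} g 0<∣g∣ = map-Σ id proj₁ (size-outside g (λ _ → false) (subst (_< size g) (sym (size-empty {n})) 0<∣g∣))

does-∈? : ∀ {n} (x : Fin n) P → does (x ∈? P) ≡ lookup P x
does-∈? zero    (true ∷ P)  = refl
does-∈? zero    (false ∷ P) = refl
does-∈? (suc x) (_ ∷ P)     = does-∈? x P

card-lookup : ∀ {n} (P : Subset n) → ∣ P ∣ ≡ size (lookup P)
card-lookup []          = refl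
card-lookup (true ∷ P)  = cong suc (card-lookup P)
card-lookup (false ∷ P) = card-lookup P

transfer-balanced : ∀ {n} {U I S U₁ I₁ : Fin n → Bool} → Splits U U₁ S → Splits I₁ I S → Balanced U₁ I₁ U I
transfer-balanced {U = U} {I} {S} {U₁} {I₁} splitU splitI z = begin
  𝟙 (U₁ z) + 𝟙 (I₁ z)             ≡⟨ cong (𝟙 (U₁ z) +_) (splitI z) ⟩
  𝟙 (U₁ z) + (𝟙 (I z) + 𝟙 (S z))  ≡⟨ swap (𝟙 (U₁ z)) (𝟙 (I z)) (𝟙 (S z)) ⟩
  (𝟙 (U₁ z) + 𝟙 (S z)) + 𝟙 (I z)  ≡⟨ cong (_+ 𝟙 (I z)) (splitU z) ⟨
  𝟙 (U z) + 𝟙 (I z)               ∎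
  where
  open ≡-Reasoning
  swap : ∀ a b c → a + (b + c) ≡ (a + c) + b
  swap = solve-∀

remove-split : ∀ {n} (U : Fin n → Bool) x → U x ≡ true → Splits U (λ z → U z ∧ not (singleton x z)) (singleton x)
remove-split U x Ux z with z ≟ x
... | yes refl rewrite Ux = refl
... | no _ with U z
...   | true  = refl
...   | false = refl

insert-split : ∀ {n} (I : Fin n → Bool) x → I x ≡ false → Splits (λ z → I z ∨ singleton x z) I (singleton x)
insert-split I x Ix z with z ≟ x
... | yes refl rewrite Ix = refl
... | no _ with I z
...   | true  = refl
...   | false = refl

transfer : ∀ {n} (U I : Fin n → Bool) x → U x ≡ true → I x ≡ false →
           Σ (Fin n → Bool) λ U₁ → Σ (Fin n → Bool) λ I₁ →
             size U₁ + 1 ≡ size U × size I₁ ≡ size I + 1 × Balanced U₁ I₁ U I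
transfer U I x Ux Ix = U₁ , I₁ , ∣U₁∣ , ∣I₁∣ , transfer-balanced splitU splitI
  where
  U₁ I₁ : Fin _ → Bool
  U₁ z = U z ∧ not (singleton x z)
  I₁ z = I z ∨ singleton x z
  splitU = remove-split U x Ux
  splitI = insert-split I x Ix
  ∣U₁∣ : size U₁ + 1 ≡ size U
  ∣U₁∣ = trans (cong (size U₁ +_) (sym (size-singleton x))) (sym (size-split splitU))
  ∣I₁∣ : size I₁ ≡ size I + 1
  ∣I₁∣ = trans (size-split splitI) (cong (size I +_) (size-singleton x))

-- Moving a point of U ∖ I into I keeps 𝟙 U + 𝟙 I pointwise, hence every count of the pair.
rebalance : ∀ {n a b} d (U I : Fin n → Bool) → b ≤ a → size U ≡ d + a → size I + d ≡ b →
            Σ (Fin n → Bool) λ U' → Σ (Fin n → Bool) λ I' →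
              size U' ≡ a × size I' ≡ b × Balanced U' I' U I
rebalance zero U I _ ∣U∣ ∣I∣ = U , I , ∣U∣ , trans (sym (ℕ.+-identityʳ _)) ∣I∣ , λ _ → refl
rebalance {a = a} {b} (suc d) U I b≤a ∣U∣ ∣I∣ with size-outside U I ∣I∣<∣U∣
  where
  ∣I∣<∣U∣ : size I < size U
  ∣I∣<∣U∣ = begin-strict
    size I           <⟨ ℕ.m<m+n (size I) (s≤s z≤n) ⟩
    size I + suc d   ≡⟨ ∣I∣ ⟩
    b                ≤⟨ b≤a ⟩
    a                ≤⟨ ℕ.m≤n+m a (suc d) ⟩
    suc d + a        ≡⟨ ∣U∣ ⟨
    size U           ∎
    where open ℕ.≤-Reasoning
... | x , Ux , Ix with transfer U I x Ux Ix
... | U₁ , I₁ , ∣U₁∣ , ∣I₁∣ , bal₁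
    with rebalance d U₁ I₁ b≤a (ℕ.suc-injective (trans (ℕ.+-comm 1 (size U₁)) (trans ∣U₁∣ ∣U∣)))
                               (trans (cong (_+ d) ∣I₁∣) (trans (ℕ.+-assoc (size I) 1 d) ∣I∣))
... | U' , I' , ∣U'∣ , ∣I'∣ , bal = U' , I' , ∣U'∣ , ∣I'∣ , λ z → trans (bal z) (bal₁ z)

residue-split : ∀ {q L r r₁} → suc L ≤ q → (r ≡ 0 → q ≤ suc r₁) → (∀ {r'} → r ≡ suc r' → r₁ ≡ r') →
                𝟙 (does (r ℕ.<? suc L)) ≡ 𝟙 (does (r ℕ.≟ 0)) + 𝟙 (does (r₁ ℕ.<? L))
residue-split {L = L} {r = zero} {r₁} L<q wraps _ = cong (λ b → 1 + 𝟙 b) (sym (dec-false (r₁ ℕ.<? L) r₁≮L))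
  where
  r₁≮L : ¬ r₁ < L
  r₁≮L r₁<L = ℕ.<⇒≱ (ℕ.<-≤-trans (s≤s r₁<L) L<q) (wraps refl)
residue-split {r = suc r} _ _ steps rewrite steps refl = refl

module Residues (q : ℕ) .{{_ : NonZero q}} where

  open import Data.Integer using (+_)

  infix 4 _≈_
  data _≈_ (x y : ℤ) : Set where
    by : ∀ t → x ≡ y ℤ.+ t ℤ.* + q → x ≈ y

  ≈-refl : ∀ {x} → x ≈ x
  ≈-refl {x} = by (+ 0) (lemma x (+ q))
    where
    lemma : ∀ x Q → x ≡ x ℤ.+ + 0 ℤ.* Q
    lemma = ℤ-Ring.solve-∀

  ≈-reflexive : ∀ {x y} → x ≡ y → x ≈ y
  ≈-reflexive refl = ≈-refl

  ≈-sym : ∀ {x y} → x ≈ y → y ≈ x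
  ≈-sym {x} {y} (by t x≡y+tq) = by (ℤ.- t) (trans (lemma y t (+ q)) (cong (λ z → z ℤ.+ ℤ.- t ℤ.* + q) (sym x≡y+tq)))
    where
    lemma : ∀ y t Q → y ≡ (y ℤ.+ t ℤ.* Q) ℤ.+ ℤ.- t ℤ.* Q
    lemma = ℤ-Ring.solve-∀

  ≈-trans : ∀ {x y z} → x ≈ y → y ≈ z → x ≈ z
  ≈-trans {x} {y} {z} (by t x≡y+tq) (by u y≡z+uq) =
    by (u ℤ.+ t) (trans x≡y+tq (trans (cong (λ w → w ℤ.+ t ℤ.* + q) y≡z+uq) (lemma z u t (+ q))))
    where
    lemma : ∀ z u t Q → (z ℤ.+ u ℤ.* Q) ℤ.+ t ℤ.* Q ≡ z ℤ.+ (u ℤ.+ t) ℤ.* Q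
    lemma = ℤ-Ring.solve-∀

  ≈-setoid : Setoid _ _
  ≈-setoid = record { _≈_ = _≈_ ; isEquivalence = record { refl = ≈-refl ; sym = ≈-sym ; trans = ≈-trans } }

  module ≈-Reasoning = SetoidReasoning ≈-setoid

  +-cong : ∀ {x y z w} → x ≈ y → z ≈ w → x ℤ.+ z ≈ y ℤ.+ w
  +-cong {y = y} {w = w} (by t x≡y+tq) (by u z≡w+uq) =
    by (t ℤ.+ u) (trans (cong₂ ℤ._+_ x≡y+tq z≡w+uq) (lemma y w t u (+ q)))
    where
    lemma : ∀ y w t u Q → (y ℤ.+ t ℤ.* Q) ℤ.+ (w ℤ.+ u ℤ.* Q) ≡ (y ℤ.+ w) ℤ.+ (t ℤ.+ u) ℤ.* Q
    lemma = ℤ-Ring.solve-∀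

  *-cong : ∀ {x y z w} → x ≈ y → z ≈ w → x ℤ.* z ≈ y ℤ.* w
  *-cong {y = y} {w = w} (by t x≡y+tq) (by u z≡w+uq) =
    by (y ℤ.* u ℤ.+ t ℤ.* w ℤ.+ t ℤ.* u ℤ.* + q) (trans (cong₂ ℤ._*_ x≡y+tq z≡w+uq) (lemma y w t u (+ q)))
    where
    lemma : ∀ y w t u Q → (y ℤ.+ t ℤ.* Q) ℤ.* (w ℤ.+ u ℤ.* Q) ≡ y ℤ.* w ℤ.+ (y ℤ.* u ℤ.+ t ℤ.* w ℤ.+ t ℤ.* u ℤ.* Q) ℤ.* Q
    lemma = ℤ-Ring.solve-∀

  +-congˡ : ∀ {x y} z → x ≈ y → z ℤ.+ x ≈ z ℤ.+ y
  +-congˡ z = +-cong (≈-refl {z})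

  +-congʳ : ∀ {x y} z → x ≈ y → x ℤ.+ z ≈ y ℤ.+ z
  +-congʳ z x≈y = +-cong x≈y ≈-refl

  %ℕ-≈ : ∀ x → + (x %ℕ q) ≈ x
  %ℕ-≈ x = ≈-sym (by (x ℤ./ℕ q) (a≡a%ℕn+[a/ℕn]*n x q))

  residue-unique : ∀ {r r'} → r < q → r' < q → + r ≈ + r' → r ≡ r'
  residue-unique {r} {r'} _ _ (by (+ zero) r≡r'+0) = trans (ℤP.+-injective r≡r'+0) (ℕ.+-identityʳ r')
  residue-unique {r} {r'} r<q _ (by (+ suc u) r≡r'+[1+u]q) = contradiction q≤r (ℕ.<⇒≱ r<q)
    where
    q≤r : q ≤ r
    q≤r = begin
      q               ≤⟨ ℕ.m≤m+n q (u * q) ⟩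
      suc u * q       ≤⟨ ℕ.m≤n+m (suc u * q) r' ⟩
      r' + suc u * q  ≡⟨ ℤP.+-injective (trans r≡r'+[1+u]q (cong (λ z → + r' ℤ.+ z) (sym (ℤP.pos-* (suc u) q)))) ⟨
      r               ∎
      where open ℕ.≤-Reasoning
  residue-unique {r} {r'} r<q r'<q r≈r'@(by ℤ.-[1+ _ ] _) = sym (residue-unique r'<q r<q (≈-sym r≈r'))

  ≈⇒%ℕ≡ : ∀ {x y} → x ≈ y → x %ℕ q ≡ y %ℕ q
  ≈⇒%ℕ≡ {x} {y} x≈y = residue-unique (n%ℕd<d x q) (n%ℕd<d y q) (≈-trans (%ℕ-≈ x) (≈-trans x≈y (≈-sym (%ℕ-≈ y))))

  %ℕ≡⇒≈ : ∀ {x y} → x %ℕ q ≡ y %ℕ q → x ≈ y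
  %ℕ≡⇒≈ {x} {y} eq = ≈-trans (≈-sym (%ℕ-≈ x)) (≈-trans (≈-reflexive (cong +_ eq)) (%ℕ-≈ y))

  ≈-substˡ-⇔ : ∀ {x y s} → x ≈ y → (x ≈ s) ⇔ (y ≈ s)
  ≈-substˡ-⇔ x≈y = mk⇔ (≈-trans (≈-sym x≈y)) (≈-trans x≈y)

  %ℕ≡⇔≈ : ∀ {x y} → (x %ℕ q ≡ y %ℕ q) ⇔ (x ≈ y)
  %ℕ≡⇔≈ = mk⇔ %ℕ≡⇒≈ ≈⇒%ℕ≡

  1+≈⇔≈-1 : ∀ {x s} → (+ 1 ℤ.+ x ≈ s) ⇔ (x ≈ s ℤ.- + 1)
  1+≈⇔≈-1 {x} {s} = mk⇔
    (λ 1+x≈s → ≈-trans (≈-reflexive (lemma₁ x)) (+-congʳ (ℤ.- + 1) 1+x≈s))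
    (λ x≈s-1 → ≈-trans (+-congˡ (+ 1) x≈s-1) (≈-reflexive (lemma₂ s)))
    where
    lemma₁ : ∀ X → X ≡ (+ 1 ℤ.+ X) ℤ.- + 1
    lemma₁ = ℤ-Ring.solve-∀
    lemma₂ : ∀ S → + 1 ℤ.+ (S ℤ.- + 1) ≡ S
    lemma₂ = ℤ-Ring.solve-∀

  %ℕ≡⇒≈⁺ : ∀ {x r} → x %ℕ q ≡ r → x ≈ + r
  %ℕ≡⇒≈⁺ {x} x%q≡r = ≈-sym (subst (λ r → + r ≈ x) x%q≡r (%ℕ-≈ x))

  %ℕ≡0⇔≈0 : ∀ {x} → (x %ℕ q ≡ 0) ⇔ (x ≈ + 0)
  %ℕ≡0⇔≈0 {x} = mk⇔ %ℕ≡⇒≈⁺ (λ x≈0 → residue-unique (n%ℕd<d x q) (>-nonZero⁻¹ q) (≈-trans (%ℕ-≈ x) x≈0))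

  pred-%ℕ-≈ : ∀ x → + suc ((x ℤ.- + 1) %ℕ q) ≈ x
  pred-%ℕ-≈ x = Equivalence.from 1+≈⇔≈-1 (%ℕ-≈ (x ℤ.- + 1))

  %ℕ≡suc⇒pred-%ℕ : ∀ {x r} → x %ℕ q ≡ suc r → (x ℤ.- + 1) %ℕ q ≡ r
  %ℕ≡suc⇒pred-%ℕ {x} {r} x%q≡1+r = residue-unique (n%ℕd<d (x ℤ.- + 1) q) (ℕ.<-trans (ℕ.n<1+n r) 1+r<q)
                                      (Equivalence.to 1+≈⇔≈-1 (≈-trans (pred-%ℕ-≈ x) (%ℕ≡⇒≈⁺ x%q≡1+r)))
    where
    1+r<q : suc r < q
    1+r<q = subst (_< q) x%q≡1+r (n%ℕd<d x q)

  %ℕ≡0⇒pred-%ℕ : ∀ {x} → x %ℕ q ≡ 0 → q ≤ suc ((x ℤ.- + 1) %ℕ q)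
  %ℕ≡0⇒pred-%ℕ {x} x%q≡0 = ℕ.≮⇒≥ λ 1+r<q →
    case residue-unique 1+r<q (>-nonZero⁻¹ q) (≈-trans (pred-%ℕ-≈ x) (%ℕ≡⇒≈⁺ x%q≡0)) of λ ()

  ⟦_⟧ : ℤ → Fin q
  ⟦ s ⟧ = fromℕ< (n%ℕd<d s q)

  ⟦⟧-≈ : ∀ s → + toℕ ⟦ s ⟧ ≈ s
  ⟦⟧-≈ s = subst (λ r → + r ≈ s) (sym (Fin.toℕ-fromℕ< (n%ℕd<d s q))) (%ℕ-≈ s)

  mod-≈ : ∀ m → + toℕ (m mod q) ≈ + m
  mod-≈ m = ⟦⟧-≈ (+ m)

  ≈⇒≡ : ∀ {x y : Fin q} → + toℕ x ≈ + toℕ y → x ≡ y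
  ≈⇒≡ {x} {y} = Fin.toℕ-injective ∘ residue-unique (Fin.toℕ<n x) (Fin.toℕ<n y)

  ≡⟦⟧⇔≈ : ∀ {x s} → (x ≡ ⟦ s ⟧) ⇔ (+ toℕ x ≈ s)
  ≡⟦⟧⇔≈ {x} {s} = mk⇔ (λ { refl → ⟦⟧-≈ s }) (λ x≈s → ≈⇒≡ (≈-trans x≈s (≈-sym (⟦⟧-≈ s))))

  singleton-⟦⟧ : ∀ s x → singleton ⟦ s ⟧ x ≡ does ((+ toℕ x ℤ.- s) %ℕ q ℕ.≟ 0)
  singleton-⟦⟧ s x = does-⇔ (⇔-trans ≡⟦⟧⇔≈ (⇔-trans ≈⇔-≈0 (⇔-sym %ℕ≡0⇔≈0))) (x ≟ ⟦ s ⟧) ((+ toℕ x ℤ.- s) %ℕ q ℕ.≟ 0)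
    where
    ≈⇔-≈0 : (+ toℕ x ≈ s) ⇔ (+ toℕ x ℤ.- s ≈ + 0)
    ≈⇔-≈0 = mk⇔ (λ x≈s → ≈-trans (+-congʳ (ℤ.- s) x≈s) (≈-reflexive (ℤP.+-inverseʳ s)))
                (λ x-s≈0 → ≈-trans (≈-reflexive (lemma (+ toℕ x) s))
                                   (≈-trans (+-congʳ s x-s≈0) (≈-reflexive (ℤP.+-identityˡ s))))
      where
      lemma : ∀ X S → X ≡ (X ℤ.- S) ℤ.+ S
      lemma = ℤ-Ring.solve-∀

  infixr 6 _⊕_
  _⊕_ : Fin q → Fin q → Fin q
  a ⊕ x = ⟦ + toℕ a ℤ.+ + toℕ x ⟧

  _⊖_ : Fin q → Fin q → Fin q
  x ⊖ a = ⟦ + toℕ x ℤ.- + toℕ a ⟧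

  ⊕-≈ : ∀ a x → + toℕ (a ⊕ x) ≈ + toℕ a ℤ.+ + toℕ x
  ⊕-≈ a x = ⟦⟧-≈ (+ toℕ a ℤ.+ + toℕ x)

  ⊕-⊖ : ∀ a y → a ⊕ (y ⊖ a) ≡ y
  ⊕-⊖ a y = ≈⇒≡ (begin
    + toℕ (a ⊕ (y ⊖ a))  ≈⟨ ⊕-≈ a (y ⊖ a) ⟩
    A ℤ.+ + toℕ (y ⊖ a)  ≈⟨ +-congˡ A (⟦⟧-≈ (Y ℤ.- A)) ⟩
    A ℤ.+ (Y ℤ.- A)      ≡⟨ lemma A Y ⟩
    Y                    ∎)
    where
    open ≈-Reasoning
    A = + toℕ a
    Y = + toℕ y
    lemma : ∀ A Y → A ℤ.+ (Y ℤ.- A) ≡ Y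
    lemma = ℤ-Ring.solve-∀

  ⊖-⊕ : ∀ a y → (a ⊕ y) ⊖ a ≡ y
  ⊖-⊕ a y = ≈⇒≡ (begin
    + toℕ ((a ⊕ y) ⊖ a)      ≈⟨ ⟦⟧-≈ (+ toℕ (a ⊕ y) ℤ.- A) ⟩
    + toℕ (a ⊕ y) ℤ.- A      ≈⟨ +-congʳ (ℤ.- A) (⊕-≈ a y) ⟩
    (A ℤ.+ Y) ℤ.- A          ≡⟨ lemma A Y ⟩
    Y                        ∎)
    where
    open ≈-Reasoning
    A = + toℕ a
    Y = + toℕ y
    lemma : ∀ A Y → (A ℤ.+ Y) ℤ.- A ≡ Y
    lemma = ℤ-Ring.solve-∀

  size-translate : ∀ (g : Fin q → Bool) a → size (g ∘ (a ⊕_)) ≡ size g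
  size-translate g a = size-permute g (a ⊕_) (_⊖ a) (⊕-⊖ a) (⊖-⊕ a)

  unit-inverse : ∀ {a} → Coprime a q → ∃ λ e → e ℤ.* + a ≈ + 1
  unit-inverse {a} a⊥q with coprime-Bézout a⊥q
  ... | Bézout.+- x y 1+yq≡xa =
    + x , by (+ y) (trans (sym (ℤP.pos-* x a)) (trans (cong +_ (sym 1+yq≡xa)) (cong (λ z → + 1 ℤ.+ z) (ℤP.pos-* y q))))
  ... | Bézout.-+ x y 1+xa≡yq = ℤ.- (+ x) , by (ℤ.- (+ y)) (begin
    ℤ.- (+ x) ℤ.* + a              ≡⟨ lemma₁ (+ x) (+ a) ⟩
    + 1 ℤ.- (+ 1 ℤ.+ + x ℤ.* + a)  ≡⟨ cong (λ z → + 1 ℤ.- z) 1+xa≡yq' ⟩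
    + 1 ℤ.- + y ℤ.* + q            ≡⟨ lemma₂ (+ y) (+ q) ⟩
    + 1 ℤ.+ ℤ.- (+ y) ℤ.* + q      ∎)
    where
    open ≡-Reasoning
    1+xa≡yq' : + 1 ℤ.+ + x ℤ.* + a ≡ + y ℤ.* + q
    1+xa≡yq' = trans (cong (λ z → + 1 ℤ.+ z) (sym (ℤP.pos-* x a))) (trans (cong +_ 1+xa≡yq) (ℤP.pos-* y q))
    lemma₁ : ∀ X A → ℤ.- X ℤ.* A ≡ + 1 ℤ.- (+ 1 ℤ.+ X ℤ.* A)
    lemma₁ = ℤ-Ring.solve-∀
    lemma₂ : ∀ Y Q → + 1 ℤ.- Y ℤ.* Q ≡ + 1 ℤ.+ ℤ.- Y ℤ.* Q
    lemma₂ = ℤ-Ring.solve-∀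

  fold-⊕-≈ : ∀ a y t → + toℕ (fold y (a ⊕_) t) ≈ + t ℤ.* + toℕ a ℤ.+ + toℕ y
  fold-⊕-≈ a y zero    = ≈-reflexive (lemma (+ toℕ y) (+ toℕ a))
    where
    lemma : ∀ Y A → Y ≡ + 0 ℤ.* A ℤ.+ Y
    lemma = ℤ-Ring.solve-∀
  fold-⊕-≈ a y (suc t) = begin
    + toℕ (a ⊕ fold y (a ⊕_) t)                 ≈⟨ ⊕-≈ a _ ⟩
    A ℤ.+ + toℕ (fold y (a ⊕_) t)               ≈⟨ +-congˡ A (fold-⊕-≈ a y t) ⟩
    A ℤ.+ (+ t ℤ.* A ℤ.+ + toℕ y)               ≡⟨ lemma (+ t) A (+ toℕ y) ⟩
    + suc t ℤ.* A ℤ.+ + toℕ y                   ∎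
    where
    open ≈-Reasoning
    A = + toℕ a
    lemma : ∀ T A Y → A ℤ.+ (T ℤ.* A ℤ.+ Y) ≡ (+ 1 ℤ.+ T) ℤ.* A ℤ.+ Y
    lemma = ℤ-Ring.solve-∀

  translation-invariant⇒full : ∀ {a} → Coprime (toℕ a) q → (g : Fin q → Bool) →
                               (∀ y → g y ≡ true → g (a ⊕ y) ≡ true) → ∀ {y} → g y ≡ true → ∀ z → g z ≡ true
  translation-invariant⇒full {a} a⊥q g closed {y} gy z with unit-inverse a⊥q
  -- z is reached from y by t = a⁻¹ (z − y) steps of + a.
  ... | e , ea≈1 = subst (λ w → g w ≡ true) (≈⇒≡ reaches-z) (orbit t)
    where
    A = + toℕ a
    Y = + toℕ y
    Z = + toℕ z
    t = (e ℤ.* (Z ℤ.- Y)) %ℕ q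
    orbit : ∀ t → g (fold y (a ⊕_) t) ≡ true
    orbit zero    = gy
    orbit (suc t) = closed _ (orbit t)
    reaches-z : + toℕ (fold y (a ⊕_) t) ≈ Z
    reaches-z = begin
      + toℕ (fold y (a ⊕_) t)          ≈⟨ fold-⊕-≈ a y t ⟩
      + t ℤ.* A ℤ.+ Y                  ≈⟨ +-congʳ Y (*-cong (%ℕ-≈ (e ℤ.* (Z ℤ.- Y))) (≈-refl {A})) ⟩
      e ℤ.* (Z ℤ.- Y) ℤ.* A ℤ.+ Y      ≡⟨ lemma₁ e Z Y A ⟩
      (Z ℤ.- Y) ℤ.* (e ℤ.* A) ℤ.+ Y    ≈⟨ +-congʳ Y (*-cong (≈-refl {Z ℤ.- Y}) ea≈1) ⟩
      (Z ℤ.- Y) ℤ.* + 1 ℤ.+ Y          ≡⟨ lemma₂ Z Y ⟩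
      Z                                ∎
      where
      open ≈-Reasoning
      lemma₁ : ∀ E Z Y A → E ℤ.* (Z ℤ.- Y) ℤ.* A ℤ.+ Y ≡ (Z ℤ.- Y) ℤ.* (E ℤ.* A) ℤ.+ Y
      lemma₁ = ℤ-Ring.solve-∀
      lemma₂ : ∀ Z Y → (Z ℤ.- Y) ℤ.* + 1 ℤ.+ Y ≡ Z
      lemma₂ = ℤ-Ring.solve-∀

module SubsetSums (q : ℕ) .{{_ : NonZero q}} where

  open import Data.Integer using (+_)
  open Residues q

  hits : ∀ {n} → Vec (Fin q) n → (Fin q → Bool) → ℕ
  hits {n} a g = count (g ∘ sumModq q a) (allChoices n)

  hitCount≡hits : ∀ {n} (a : Vec (Fin q) n) P → hitCount q a P ≡ hits a (lookup P)
  hitCount≡hits {n} a P = trans (length-filter-count (λ ε → sumModq q a ε ∈? P) (allChoices n))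
                                (count-cong (λ ε → does-∈? (sumModq q a ε) P) (allChoices n))

  sumModq-true∷ : ∀ {n} a (as : Vec (Fin q) n) ε → sumModq q (a ∷ as) (true ∷ ε) ≡ a ⊕ sumModq q as ε
  sumModq-true∷ a as ε = ≈⇒≡ (begin
    + toℕ ((toℕ a + w) mod q)        ≈⟨ mod-≈ (toℕ a + w) ⟩
    + toℕ a ℤ.+ + w                  ≈⟨ +-congˡ (+ toℕ a) (≈-sym (mod-≈ w)) ⟩
    + toℕ a ℤ.+ + toℕ (w mod q)      ≈⟨ ⊕-≈ a (w mod q) ⟨
    + toℕ (a ⊕ w mod q)              ∎)
    where
    open ≈-Reasoning
    w = weightedSum as ε

  hits-∷ : ∀ {n} a (as : Vec (Fin q) n) g → hits (a ∷ as) g ≡ hits as g + hits as (g ∘ (a ⊕_))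
  hits-∷ {n} a as g = begin
    hits (a ∷ as) g
      ≡⟨ count-++ _ (map (false ∷_) (allChoices n)) _ ⟩
    count _ (map (false ∷_) (allChoices n)) + count _ (map (true ∷_) (allChoices n))
      ≡⟨ cong₂ _+_ (count-map _ (false ∷_) (allChoices n)) (count-map _ (true ∷_) (allChoices n)) ⟩
    hits as g + count (λ ε → g (sumModq q (a ∷ as) (true ∷ ε))) (allChoices n)
      ≡⟨ cong (_+_ (hits as g)) (count-cong (cong g ∘ sumModq-true∷ a as) (allChoices n)) ⟩
    hits as g + hits as (g ∘ (a ⊕_))
      ∎
    where open ≡-Reasoning

  hits-split : ∀ {n} (as : Vec (Fin q) n) {f g h} → Splits f g h → hits as f ≡ hits as g + hits as h
  hits-split as split = count-split (split ∘ sumModq q as) (allChoices _)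

  hits-balanced : ∀ {n} (as : Vec (Fin q) n) {f g u v} → Balanced f g u v →
                  hits as f + hits as g ≡ hits as u + hits as v
  hits-balanced as bal = count-balanced (bal ∘ sumModq q as) (allChoices _)

module ModBinomial (q : ℕ) .{{_ : NonZero q}} where

  open import Data.Integer using (+_)
  open Residues q
  open SubsetSums q

  ≡-mod? : ℤ → ℕ → Bool
  ≡-mod? s i = does ((+ i) %ℕ q ℕ.≟ s %ℕ q)

  term : ℕ → ℤ → ℕ → ℕ
  term n s i = if ≡-mod? s i then n C i else 0

  binomMod-∑ : ∀ n s → binomMod q n s ≡ ∑[ i < suc n ] term n s (toℕ i)
  binomMod-∑ n s = sum-filter (λ j → (+ j) %ℕ q ℕ.≟ s %ℕ q) (n C_) id (suc n)

  ≡-mod?-suc : ∀ s i → ≡-mod? s (suc i) ≡ ≡-mod? (s ℤ.- + 1) i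
  ≡-mod?-suc s i = does-⇔ (⇔-trans %ℕ≡⇔≈ (⇔-trans (1+≈⇔≈-1 {+ i} {s}) (⇔-sym %ℕ≡⇔≈)))
                           ((+ suc i) %ℕ q ℕ.≟ s %ℕ q) ((+ i) %ℕ q ℕ.≟ (s ℤ.- + 1) %ℕ q)

  term-suc : ∀ n s i → term (suc n) s (suc i) ≡ term n (s ℤ.- + 1) i + term n s (suc i)
  term-suc n s i rewrite sym (≡-mod?-suc s i) with ≡-mod? s (suc i)
  ... | true  = sym (nCk+nC[k+1]≡[n+1]C[k+1] n i)
  ... | false = refl

  term-beyond : ∀ n s → term n s (suc n) ≡ 0
  term-beyond n s with ≡-mod? s (suc n)
  ... | true  = k>n⇒nCk≡0 (ℕ.n<1+n n)
  ... | false = refl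

  binomMod-pascal : ∀ n s → binomMod q (suc n) s ≡ binomMod q n s + binomMod q n (s ℤ.- + 1)
  binomMod-pascal n s = begin
    binomMod q (suc n) s
      ≡⟨ binomMod-∑ (suc n) s ⟩
    t₀ + ∑[ i < suc n ] term (suc n) s (suc (toℕ i))
      ≡⟨ cong (_+_ t₀) (sum-cong-≗ {suc n} (λ i → term-suc n s (toℕ i))) ⟩
    t₀ + ∑[ i < suc n ] (term n s' (toℕ i) + term n s (suc (toℕ i)))
      ≡⟨ cong (_+_ t₀) (∑-distrib-+ {suc n} (term n s' ∘ toℕ) (term n s ∘ suc ∘ toℕ)) ⟩
    t₀ + (A + ∑[ i < suc n ] term n s (suc (toℕ i)))
      ≡⟨ cong (λ m → t₀ + (A + m)) (trans (∑-last (term n s ∘ suc)) (cong (_+_ B) (term-beyond n s))) ⟩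
    t₀ + (A + (B + 0))
      ≡⟨ regroup t₀ A B ⟩
    (t₀ + B) + A
      ≡⟨ cong₂ _+_ (binomMod-∑ n s) (binomMod-∑ n s') ⟨
    binomMod q n s + binomMod q n s'
      ∎
    where
    open ≡-Reasoning
    s' = s ℤ.- + 1
    t₀ = term n s 0
    A = ∑[ i < suc n ] term n s' (toℕ i)
    B = ∑[ i < n ] term n s (suc (toℕ i))
    regroup : ∀ a c x → a + (c + (x + 0)) ≡ (a + x) + c
    regroup = solve-∀

  one : Fin q
  one = 1 mod q

  if-𝟙 : ∀ b → (if b then 1 else 0) ≡ 𝟙 b
  if-𝟙 true  = refl
  if-𝟙 false = refl

  ones : ∀ n → Vec (Fin q) n
  ones n = replicate n one

  ≡-mod?-zero : ∀ s → ≡-mod? s 0 ≡ singleton ⟦ s ⟧ (0 mod q)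
  ≡-mod?-zero s = does-⇔ (⇔-trans (%ℕ≡⇔≈ {+ 0} {s}) (⇔-sym (⇔-trans ≡⟦⟧⇔≈ (≈-substˡ-⇔ (mod-≈ 0)))))
                         ((+ 0) %ℕ q ℕ.≟ s %ℕ q) (0 mod q ≟ ⟦ s ⟧)

  singleton-pred : ∀ s x → singleton ⟦ s ℤ.- + 1 ⟧ x ≡ singleton ⟦ s ⟧ (one ⊕ x)
  singleton-pred s x =
    does-⇔ (⇔-trans ≡⟦⟧⇔≈ (⇔-trans (⇔-sym (1+≈⇔≈-1 {+ toℕ x} {s})) (⇔-sym (⇔-trans ≡⟦⟧⇔≈ (≈-substˡ-⇔ one⊕x≈1+x)))))
           (x ≟ ⟦ s ℤ.- + 1 ⟧) (one ⊕ x ≟ ⟦ s ⟧)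
    where
    one⊕x≈1+x : + toℕ (one ⊕ x) ≈ + 1 ℤ.+ + toℕ x
    one⊕x≈1+x = ≈-trans (⊕-≈ one x) (+-congʳ (+ toℕ x) (mod-≈ 1))

  binomMod≡hits : ∀ n s → binomMod q n s ≡ hits (ones n) (singleton ⟦ s ⟧)
  binomMod≡hits zero    s = trans (binomMod-∑ 0 s) (cong (_+ 0) (trans (if-𝟙 (≡-mod? s 0)) (cong 𝟙 (≡-mod?-zero s))))
  binomMod≡hits (suc n) s = begin
    binomMod q (suc n) s
      ≡⟨ binomMod-pascal n s ⟩
    binomMod q n s + binomMod q n (s ℤ.- + 1)
      ≡⟨ cong₂ _+_ (binomMod≡hits n s) (binomMod≡hits n (s ℤ.- + 1)) ⟩
    hits (ones n) (singleton ⟦ s ⟧) + hits (ones n) (singleton ⟦ s ℤ.- + 1 ⟧)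
      ≡⟨ cong (_+_ (hits (ones n) (singleton ⟦ s ⟧))) (count-cong (singleton-pred s ∘ sumModq q (ones n)) (allChoices n)) ⟩
    hits (ones n) (singleton ⟦ s ⟧) + hits (ones n) (singleton ⟦ s ⟧ ∘ (one ⊕_))
      ≡⟨ hits-∷ one (ones n) (singleton ⟦ s ⟧) ⟨
    hits (ones (suc n)) (singleton ⟦ s ⟧)
      ∎
    where open ≡-Reasoning

range : ℤ → ℕ → List ℤ
range s zero    = []
range s (suc L) = s ∷ range (s ℤ.+ ℤ.1ℤ) L

module Arcs (q : ℕ) .{{_ : NonZero q}} where

  open import Data.Integer using (+_)
  open Residues q
  open SubsetSums q
  open ModBinomial q

  arc : ℤ → ℕ → Fin q → Bool
  arc s L x = does ((+ toℕ x ℤ.- s) %ℕ q ℕ.<? L)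

  arc-split : ∀ s L → suc L ≤ q → Splits (arc s (suc L)) (singleton ⟦ s ⟧) (arc (s ℤ.+ + 1) L)
  arc-split s L L<q x = begin
    𝟙 (does (d %ℕ q ℕ.<? suc L))
      ≡⟨ residue-split L<q (%ℕ≡0⇒pred-%ℕ {d}) (%ℕ≡suc⇒pred-%ℕ {d}) ⟩
    𝟙 (does (d %ℕ q ℕ.≟ 0)) + 𝟙 (does ((d ℤ.- + 1) %ℕ q ℕ.<? L))
      ≡⟨ cong₂ (λ a b → 𝟙 a + 𝟙 b) (singleton-⟦⟧ s x) arc-next ⟨
    𝟙 (singleton ⟦ s ⟧ x) + 𝟙 (arc (s ℤ.+ + 1) L x)
      ∎
    where
    open ≡-Reasoning
    d = + toℕ x ℤ.- s
    lemma : ∀ X S → X ℤ.- (S ℤ.+ + 1) ≡ (X ℤ.- S) ℤ.- + 1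
    lemma = ℤ-Ring.solve-∀
    arc-next : arc (s ℤ.+ + 1) L x ≡ does ((d ℤ.- + 1) %ℕ q ℕ.<? L)
    arc-next = cong (λ e → does (e %ℕ q ℕ.<? L)) (lemma (+ toℕ x) s)

  arc-member : ∀ s L x t → t < L → L ≤ q → + toℕ x ≈ s ℤ.+ + t → arc s L x ≡ true
  arc-member s L x t t<L L≤q x≈s+t = subst (λ r → does (r ℕ.<? L) ≡ true) (sym residue≡t) (dec-true (t ℕ.<? L) t<L)
    where
    residue≡t : (+ toℕ x ℤ.- s) %ℕ q ≡ t
    residue≡t = residue-unique (n%ℕd<d (+ toℕ x ℤ.- s) q) (ℕ.<-≤-trans t<L L≤q)
      (≈-trans (%ℕ-≈ _) (≈-trans (+-congʳ (ℤ.- s) x≈s+t) (≈-reflexive (cancel s (+ t)))))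
      where
      cancel : ∀ S T → (S ℤ.+ T) ℤ.- S ≡ T
      cancel = ℤ-Ring.solve-∀

  hits-arc : ∀ n s L → L ≤ q → hits (ones n) (arc s L) ≡ sum (map (binomMod q n) (range s L))
  hits-arc n s zero    _   = count-none (λ _ → refl) (allChoices n)
  hits-arc n s (suc L) L<q = begin
    hits (ones n) (arc s (suc L))
      ≡⟨ hits-split (ones n) {g = singleton ⟦ s ⟧} {h = arc (s ℤ.+ + 1) L} (arc-split s L L<q) ⟩
    hits (ones n) (singleton ⟦ s ⟧) + hits (ones n) (arc (s ℤ.+ + 1) L)
      ≡⟨ cong₂ _+_ (binomMod≡hits n s) (sym (hits-arc n (s ℤ.+ + 1) L (ℕ.<⇒≤ L<q))) ⟨
    binomMod q n s + sum (map (binomMod q n) (range (s ℤ.+ + 1) L))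
      ∎
    where open ≡-Reasoning

  size-arc : ∀ s L → L ≤ q → size (arc s L) ≡ L
  size-arc s zero    _   = size-empty {q}
  size-arc s (suc L) L<q =
    trans (size-split (arc-split s L L<q)) (cong₂ _+_ (size-singleton ⟦ s ⟧) (size-arc (s ℤ.+ + 1) L (ℕ.<⇒≤ L<q)))

module Window where

  open import Data.Integer using (+_; +≤+; +<+)

  offset-≤⇔ : ∀ {x y : ℤ} c {a b} → x ℤ.+ c ≡ + a → y ℤ.+ c ≡ + b → (x ℤ.≤ y) ⇔ (a ≤ b)
  offset-≤⇔ {x} {y} c x+c≡a y+c≡b = mk⇔
    (λ x≤y → ℤP.drop‿+≤+ (subst₂ ℤ._≤_ x+c≡a y+c≡b (ℤP.+-monoˡ-≤ c x≤y)))
    (λ a≤b → subst₂ ℤ._≤_ (cancel x c) (cancel y c)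
               (ℤP.+-monoˡ-≤ (ℤ.- c) (subst₂ ℤ._≤_ (sym x+c≡a) (sym y+c≡b) (+≤+ a≤b))))
    where
    cancel : ∀ x c → (x ℤ.+ c) ℤ.- c ≡ x
    cancel = ℤ-Ring.solve-∀

  offset-<⇔ : ∀ {x y : ℤ} c {a b} → x ℤ.+ c ≡ + a → y ℤ.+ c ≡ + b → (x ℤ.< y) ⇔ (a < b)
  offset-<⇔ {x} {y} c x+c≡a y+c≡b = mk⇔
    (λ x<y → ℤP.drop‿+<+ (subst₂ ℤ._<_ x+c≡a y+c≡b (ℤP.+-monoˡ-< c x<y)))
    (λ a<b → subst₂ ℤ._<_ (cancel x c) (cancel y c)
               (ℤP.+-monoˡ-< (ℤ.- c) (subst₂ ℤ._<_ (sym x+c≡a) (sym y+c≡b) (+<+ a<b))))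
    where
    cancel : ∀ x c → (x ℤ.+ c) ℤ.- c ≡ x
    cancel = ℤ-Ring.solve-∀

  InWindow : ℕ → ℕ → ℤ → Set
  InWindow n k j = (+ n ℤ.- + k ℤ.≤ + 2 ℤ.* j) × (+ 2 ℤ.* j ℤ.< + n ℤ.+ + k)

  InWindow⇔ : ∀ n k j T → j ℤ.+ + k ≡ + T → InWindow n k j ⇔ ((n + k ≤ T + T) × (T + T < (n + k) + (k + k)))
  InWindow⇔ n k j T j+k≡T = offset-≤⇔ 2k (lemma₁ (+ n) (+ k)) 2j+2k≡2T ×-⇔ offset-<⇔ 2k 2j+2k≡2T refl
    where
    2k = + k ℤ.+ + k
    lemma₁ : ∀ N K → (N ℤ.- K) ℤ.+ (K ℤ.+ K) ≡ N ℤ.+ K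
    lemma₁ = ℤ-Ring.solve-∀
    lemma₂ : ∀ J K → + 2 ℤ.* J ℤ.+ (K ℤ.+ K) ≡ (J ℤ.+ K) ℤ.+ (J ℤ.+ K)
    lemma₂ = ℤ-Ring.solve-∀
    2j+2k≡2T : + 2 ℤ.* j ℤ.+ 2k ≡ + (T + T)
    2j+2k≡2T = trans (lemma₂ j (+ k)) (cong₂ ℤ._+_ j+k≡T j+k≡T)

  range-++ : ∀ c a b → range c (a + b) ≡ range c a ++ range (c ℤ.+ + a) b
  range-++ c zero    b = cong (λ c' → range c' b) (sym (ℤP.+-identityʳ c))
  range-++ c (suc a) b = cong (c ∷_) (trans (range-++ (c ℤ.+ + 1) a b) (cong (λ c' → range (c ℤ.+ + 1) a ++ range c' b) (step c (+ a))))
    where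
    step : ∀ C A → (C ℤ.+ + 1) ℤ.+ A ≡ C ℤ.+ (+ 1 ℤ.+ A)
    step = ℤ-Ring.solve-∀

  All-range : ∀ {P : ℤ → Set} c L → (∀ t → t < L → P (c ℤ.+ + t)) → All P (range c L)
  All-range         c zero    _ = []
  All-range {P = P} c (suc L) P[c+t] =
    subst P (ℤP.+-identityʳ c) (P[c+t] 0 (s≤s z≤n)) ∷
    All-range (c ℤ.+ + 1) L (λ t t<L → subst P (sym (step c (+ t))) (P[c+t] (suc t) (s≤s t<L)))
    where
    step : ∀ C T → (C ℤ.+ + 1) ℤ.+ T ≡ C ℤ.+ (+ 1 ℤ.+ T)
    step = ℤ-Ring.solve-∀

  applyUpTo-range : ∀ (h : ℕ → ℤ) c N → (∀ t → h t ≡ c ℤ.+ + t) → applyUpTo h N ≡ range c N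
  applyUpTo-range h c zero    _ = refl
  applyUpTo-range h c (suc N) h≡c+t = cong₂ _∷_ (trans (h≡c+t 0) (ℤP.+-identityʳ c))
    (applyUpTo-range (h ∘ suc) (c ℤ.+ + 1) N (λ t → trans (h≡c+t (suc t)) (step c (+ t))))
    where
    step : ∀ C T → C ℤ.+ (+ 1 ℤ.+ T) ≡ (C ℤ.+ + 1) ℤ.+ T
    step = ℤ-Ring.solve-∀

  ⌈/2⌉-lower : ∀ m → m ≤ ⌈ m /2⌉ + ⌈ m /2⌉
  ⌈/2⌉-lower m = subst (_≤ ⌈ m /2⌉ + ⌈ m /2⌉) (ℕ.⌊n/2⌋+⌈n/2⌉≡n m) (ℕ.+-monoˡ-≤ ⌈ m /2⌉ (ℕ.⌊n/2⌋≤⌈n/2⌉ m))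

  ⌈/2⌉-upper : ∀ m → ⌈ m /2⌉ + ⌈ m /2⌉ ≤ suc m
  ⌈/2⌉-upper zero          = z≤n
  ⌈/2⌉-upper (suc zero)    = ℕ.≤-refl
  ⌈/2⌉-upper (suc (suc m)) = s≤s (subst (_≤ suc (suc m)) (sym (ℕ.+-suc ⌈ m /2⌉ ⌈ m /2⌉)) (s≤s (⌈/2⌉-upper m)))

  module _ (X : ℕ) where

    private
      u = ⌈ X /2⌉
      lower = ⌈/2⌉-lower X
      upper = ⌈/2⌉-upper X

    below-window : ∀ {t} → t < u → ¬ (X ≤ t + t)
    below-window {t} t<u = ℕ.<⇒≱ (s≤s⁻¹ (begin
      suc (suc (t + t))  ≡⟨ cong suc (ℕ.+-suc t t) ⟨
      suc t + suc t      ≤⟨ ℕ.+-mono-≤ t<u t<u ⟩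
      u + u              ≤⟨ upper ⟩
      suc X              ∎))
      where open ℕ.≤-Reasoning

    inside-window : ∀ {k t} → t < k → X ≤ (u + t) + (u + t) × (u + t) + (u + t) < X + (k + k)
    inside-window {k} {t} t<k = ℕ.≤-trans lower (ℕ.+-mono-≤ (ℕ.m≤m+n u t) (ℕ.m≤m+n u t)) , (begin
      suc ((u + t) + (u + t))  ≡⟨ lemma₁ u t ⟩
      (u + u) + suc (t + t)    ≤⟨ ℕ.+-monoˡ-≤ (suc (t + t)) upper ⟩
      suc X + suc (t + t)      ≡⟨ lemma₂ X t ⟩
      X + (suc t + suc t)      ≤⟨ ℕ.+-monoʳ-≤ X (ℕ.+-mono-≤ t<k t<k) ⟩
      X + (k + k)              ∎)
      where
      open ℕ.≤-Reasoning
      lemma₁ : ∀ u t → suc ((u + t) + (u + t)) ≡ (u + u) + suc (t + t)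
      lemma₁ = solve-∀
      lemma₂ : ∀ X t → suc X + suc (t + t) ≡ X + (suc t + suc t)
      lemma₂ = solve-∀

    above-window : ∀ {k t} → ¬ ((u + k) + t) + ((u + k) + t) < X + (k + k)
    above-window {k} {t} = ℕ.≤⇒≯ (begin
      X + (k + k)                        ≤⟨ ℕ.+-monoˡ-≤ (k + k) lower ⟩
      (u + u) + (k + k)                  ≡⟨ lemma u k ⟩
      (u + k) + (u + k)                  ≤⟨ ℕ.+-mono-≤ (ℕ.m≤m+n (u + k) t) (ℕ.m≤m+n (u + k) t) ⟩
      ((u + k) + t) + ((u + k) + t)      ∎)
      where
      open ℕ.≤-Reasoning
      lemma : ∀ u k → (u + u) + (k + k) ≡ (u + k) + (u + k)
      lemma = solve-∀

  -- The window is the run of k integers starting at ⌈(n − k)/2⌉ = −k + ⌈(n + k)/2⌉.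
  windowStart : ℕ → ℕ → ℤ
  windowStart n k = ℤ.- + k ℤ.+ + ⌈ (n + k) /2⌉

  window≡range : ∀ n k → window n k ≡ range (windowStart n k) k
  window≡range n k = begin
    window n k
      ≡⟨ cong (filter P?) candidates≡range ⟩
    filter P? (range c₀ N)
      ≡⟨ cong (filter P? ∘ range c₀) N≡u+[k+v] ⟩
    filter P? (range c₀ (u + (k + v)))
      ≡⟨ cong (filter P?) (trans (range-++ c₀ u (k + v)) (cong (range c₀ u ++_) (range-++ c k v))) ⟩
    filter P? (range c₀ u ++ range c k ++ range (c ℤ.+ + k) v)
      ≡⟨ trans (filter-++ P? (range c₀ u) _) (cong (filter P? (range c₀ u) ++_) (filter-++ P? (range c k) _)) ⟩
    filter P? (range c₀ u) ++ filter P? (range c k) ++ filter P? (range (c ℤ.+ + k) v)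
      ≡⟨ cong₂ _++_ (filter-none P? below) (cong₂ _++_ (filter-all P? inside) (filter-none P? above)) ⟩
    range c k ++ []
      ≡⟨ ++-identityʳ (range c k) ⟩
    range c k
      ∎
    where
    open ≡-Reasoning
    P? : ∀ j → Dec (InWindow n k j)
    P? j = ((+ n) ℤ.- (+ k) ℤ.≤? (+ 2) ℤ.* j) ×-dec ((+ 2) ℤ.* j ℤ.<? (+ n) ℤ.+ (+ k))
    X = n + k
    N = suc (n + (k + k))
    u = ⌈ X /2⌉
    v = suc X ∸ u
    c₀ = ℤ.- + k
    c = windowStart n k
    candidates≡range : candidates n k ≡ range c₀ N
    candidates≡range = trans (map-applyUpTo id _ N) (applyUpTo-range _ c₀ N (λ _ → refl))
    N≡u+[k+v] : N ≡ u + (k + v)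
    N≡u+[k+v] = begin
      suc (n + (k + k))  ≡⟨ lemma n k ⟩
      k + suc X          ≡⟨ cong (_+_ k) (ℕ.m+[n∸m]≡n (ℕ.m≤n⇒m≤1+n (ℕ.⌈n/2⌉≤n X))) ⟨
      k + (u + v)        ≡⟨ ℕ.+-comm k (u + v) ⟩
      (u + v) + k        ≡⟨ ℕ.+-assoc u v k ⟩
      u + (v + k)        ≡⟨ cong (_+_ u) (ℕ.+-comm v k) ⟩
      u + (k + v)        ∎
      where
      lemma : ∀ n k → suc (n + (k + k)) ≡ k + suc (n + k)
      lemma = solve-∀
    below : All (¬_ ∘ InWindow n k) (range c₀ u)
    below = All-range c₀ u λ t t<u inW →
      below-window X t<u (proj₁ (Equivalence.to (InWindow⇔ n k (c₀ ℤ.+ + t) t (shift₁ (+ k) (+ t))) inW))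
      where
      shift₁ : ∀ K T → (ℤ.- K ℤ.+ T) ℤ.+ K ≡ T
      shift₁ = ℤ-Ring.solve-∀
    inside : All (InWindow n k) (range c k)
    inside = All-range c k λ t t<k →
      Equivalence.from (InWindow⇔ n k (c ℤ.+ + t) (u + t) (shift₂ (+ k) (+ u) (+ t))) (inside-window X t<k)
      where
      shift₂ : ∀ K U T → ((ℤ.- K ℤ.+ U) ℤ.+ T) ℤ.+ K ≡ U ℤ.+ T
      shift₂ = ℤ-Ring.solve-∀
    above : All (¬_ ∘ InWindow n k) (range (c ℤ.+ + k) v)
    above = All-range (c ℤ.+ + k) v λ t _ inW →
      above-window X (proj₂ (Equivalence.to (InWindow⇔ n k _ ((u + k) + t) (shift₃ (+ k) (+ u) (+ t))) inW))
      where
      shift₃ : ∀ K U T → (((ℤ.- K ℤ.+ U) ℤ.+ K) ℤ.+ T) ℤ.+ K ≡ (U ℤ.+ K) ℤ.+ T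
      shift₃ = ℤ-Ring.solve-∀

  windowStart-suc : ∀ n k → windowStart (suc n) (suc k) ≡ windowStart n k
  windowStart-suc n k = trans (cong (λ m → ℤ.- + suc k ℤ.+ + ⌈ suc m /2⌉) (ℕ.+-suc n k)) (lemma (+ k) (+ ⌈ (n + k) /2⌉))
    where
    lemma : ∀ K H → ℤ.- (+ 1 ℤ.+ K) ℤ.+ (+ 1 ℤ.+ H) ≡ ℤ.- K ℤ.+ H
    lemma = ℤ-Ring.solve-∀

  windowStart-+2 : ∀ n k → windowStart n (suc (suc k)) ≡ windowStart n k ℤ.- + 1
  windowStart-+2 n k = trans (cong (λ m → ℤ.- + suc (suc k) ℤ.+ + ⌈ m /2⌉) (trans (ℕ.+-suc n (suc k)) (cong suc (ℕ.+-suc n k))))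
                             (lemma (+ k) (+ ⌈ (n + k) /2⌉))
    where
    lemma : ∀ K H → ℤ.- (+ 1 ℤ.+ (+ 1 ℤ.+ K)) ℤ.+ (+ 1 ℤ.+ H) ≡ (ℤ.- K ℤ.+ H) ℤ.- + 1
    lemma = ℤ-Ring.solve-∀

  map-pred-range : ∀ s L → map (λ j → j ℤ.- + 1) (range s L) ≡ range (s ℤ.- + 1) L
  map-pred-range s zero    = refl
  map-pred-range s (suc L) = cong ((s ℤ.- + 1) ∷_) (trans (map-pred-range (s ℤ.+ + 1) L) (cong (λ s' → range s' L) (lemma s)))
    where
    lemma : ∀ S → (S ℤ.+ + 1) ℤ.- + 1 ≡ (S ℤ.- + 1) ℤ.+ + 1
    lemma = ℤ-Ring.solve-∀

  range-pred : ∀ s L → range (s ℤ.- + 1) (suc L) ≡ (s ℤ.- + 1) ∷ range s L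
  range-pred s L = cong (λ s' → (s ℤ.- + 1) ∷ range s' L) (lemma s)
    where
    lemma : ∀ S → (S ℤ.- + 1) ℤ.+ + 1 ≡ S
    lemma = ℤ-Ring.solve-∀

module Bound (q : ℕ) .{{_ : NonZero q}} where

  open import Data.Integer using (+_)
  open Residues q
  open SubsetSums q
  open ModBinomial q
  open Arcs q
  open Window

  Σbinom : ℕ → ℤ → ℕ → ℕ
  Σbinom n s L = sum (map (binomMod q n) (range s L))

  bound≡Σbinom : ∀ n k → bound q n k ≡ Σbinom n (windowStart n k) k
  bound≡Σbinom n k = cong (sum ∘ map (binomMod q n)) (window≡range n k)

  Σbinom-pred : ∀ n s L → Σbinom n (s ℤ.- + 1) (suc L) ≡ binomMod q n (s ℤ.- + 1) + Σbinom n s L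
  Σbinom-pred n s L = cong (sum ∘ map (binomMod q n)) (range-pred s L)

  Σbinom-shift : ∀ n s L → sum (map (λ j → binomMod q n (j ℤ.- + 1)) (range s L)) ≡ Σbinom n (s ℤ.- + 1) L
  Σbinom-shift n s L = cong sum (trans (map-∘ (range s L)) (cong (map (binomMod q n)) (map-pred-range s L)))

  bound-pascal : ∀ n k → bound q (suc n) (suc k) ≡ bound q n (suc (suc k)) + bound q n k
  bound-pascal n k = begin
    bound q (suc n) (suc k)
      ≡⟨ trans (bound≡Σbinom (suc n) (suc k)) (cong (λ s → Σbinom (suc n) s (suc k)) (windowStart-suc n k)) ⟩
    Σbinom (suc n) s (suc k)
      ≡⟨ cong sum (map-cong (binomMod-pascal n) (range s (suc k))) ⟩
    sum (map (λ j → binomMod q n j + binomMod q n (j ℤ.- + 1)) (range s (suc k)))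
      ≡⟨ sum-map-+ (binomMod q n) _ (range s (suc k)) ⟩
    Σbinom n s (suc k) + sum (map (λ j → binomMod q n (j ℤ.- + 1)) (range s (suc k)))
      ≡⟨ cong (_+_ (Σbinom n s (suc k))) (trans (Σbinom-shift n s (suc k)) (Σbinom-pred n s k)) ⟩
    Σbinom n s (suc k) + (binomMod q n (s ℤ.- + 1) + Σbinom n s k)
      ≡⟨ regroup (Σbinom n s (suc k)) (binomMod q n (s ℤ.- + 1)) (Σbinom n s k) ⟩
    (binomMod q n (s ℤ.- + 1) + Σbinom n s (suc k)) + Σbinom n s k
      ≡⟨ cong (_+ Σbinom n s k) (Σbinom-pred n s (suc k)) ⟨
    Σbinom n (s ℤ.- + 1) (suc (suc k)) + Σbinom n s k
      ≡⟨ cong (λ s' → Σbinom n s' (suc (suc k)) + Σbinom n s k) (windowStart-+2 n k) ⟨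
    Σbinom n (windowStart n (suc (suc k))) (suc (suc k)) + Σbinom n s k
      ≡⟨ cong₂ _+_ (bound≡Σbinom n (suc (suc k))) (bound≡Σbinom n k) ⟨
    bound q n (suc (suc k)) + bound q n k
      ∎
    where
    open ≡-Reasoning
    s = windowStart n k
    regroup : ∀ a b c → a + (b + c) ≡ (b + a) + c
    regroup = solve-∀

  bound-attained : ∀ n k → k ≤ q → hits (ones n) (arc (windowStart n k) k) ≡ bound q n k
  bound-attained n k k≤q = trans (hits-arc n (windowStart n k) k k≤q) (sym (bound≡Σbinom n k))

  bound-full : ∀ n → bound q n q ≡ length (allChoices n)
  bound-full n = trans (sym (bound-attained n q ℕ.≤-refl))
                       (count-all (λ ε → size≡n⇒full _ (size-arc (windowStart n q) q ℕ.≤-refl) _) (allChoices n))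

  bound-positive : ∀ k → 1 ≤ k → k ≤ q → 1 ≤ bound q 0 k
  bound-positive (suc k) _ k≤q = subst (λ m → 1 ≤ m) (trans (cong (λ b → 𝟙 b + 0) (sym 0∈arc)) (bound-attained 0 (suc k) k≤q)) ℕ.≤-refl
    where
    0∈arc : arc (windowStart 0 (suc k)) (suc k) (0 mod q) ≡ true
    0∈arc = arc-member (windowStart 0 (suc k)) (suc k) (0 mod q) ⌊ suc k /2⌋ (ℕ.⌊n/2⌋<n k) k≤q (begin
      + toℕ (0 mod q)                              ≈⟨ mod-≈ 0 ⟩
      + 0                                          ≡⟨ ℤP.+-inverseˡ (+ suc k) ⟨
      ℤ.- + suc k ℤ.+ + suc k                      ≡⟨ cong (λ m → ℤ.- + suc k ℤ.+ + m) (ℕ.⌊n/2⌋+⌈n/2⌉≡n (suc k)) ⟨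
      ℤ.- + suc k ℤ.+ (+ ⌊ suc k /2⌋ ℤ.+ + ⌈ suc k /2⌉)  ≡⟨ lemma (+ suc k) (+ ⌊ suc k /2⌋) (+ ⌈ suc k /2⌉) ⟩
      windowStart 0 (suc k) ℤ.+ + ⌊ suc k /2⌋      ∎)
      where
      open ≈-Reasoning
      lemma : ∀ K F C → ℤ.- K ℤ.+ (F ℤ.+ C) ≡ (ℤ.- K ℤ.+ C) ℤ.+ F
      lemma = ℤ-Ring.solve-∀

module UpperBound (q : ℕ) .{{_ : NonZero q}} where

  open Residues q
  open SubsetSums q
  open Bound q

  Units : ∀ {n} → Vec (Fin q) n → Set
  Units as = ∀ i → Coprime (toℕ (lookup as i)) q

  proper-overlap-with-translate : ∀ {a} → Coprime (toℕ a) q → (g : Fin q → Bool) → 0 < size g → size g < q →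
                                  ∃ λ r → size (λ x → g x ∧ g (a ⊕ x)) + suc r ≡ size g
  proper-overlap-with-translate {a} a⊥q g 0<∣g∣ ∣g∣<q with size (λ x → g x ∧ not (g (a ⊕ x))) in ∣g∖g'∣
  ... | suc r = r , trans (cong (_+_ (size (λ x → g x ∧ g (a ⊕ x)))) (sym ∣g∖g'∣))
                          (sym (size-split (λ x → ∧-not-split (g x) (g (a ⊕ x)))))
  ... | zero  = contradiction (subst (_< q) ∣g∣≡q ∣g∣<q) (ℕ.<-irrefl refl)
    where
    closed : ∀ y → g y ≡ true → g (a ⊕ y) ≡ true
    closed y gy with g (a ⊕ y) in eq | size≡0⇒empty _ ∣g∖g'∣ y
    ... | true  | _ = refl
    ... | false | g∖g'≡false rewrite gy with () ← g∖g'≡false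
    ∣g∣≡q : size g ≡ q
    ∣g∣≡q with y , gy ← nonempty g 0<∣g∣ =
      trans (size-cong (translation-invariant⇒full a⊥q g closed gy)) (size-full {q})

  hits-∷-rebalanced : ∀ {n k} a (as : Vec (Fin q) n) → Coprime (toℕ a) q → (g : Fin q → Bool) →
                      size g ≡ suc k → suc k < q →
                      Σ (Fin q → Bool) λ U' → Σ (Fin q → Bool) λ I' →
                        size U' ≡ suc (suc k) × size I' ≡ k × hits (a ∷ as) g ≡ hits as U' + hits as I'
  hits-∷-rebalanced {n} {k} a as a⊥q g ∣g∣≡1+k 1+k<q
    with proper-overlap-with-translate a⊥q g (subst (0 <_) (sym ∣g∣≡1+k) (s≤s z≤n)) (subst (_< q) (sym ∣g∣≡1+k) 1+k<q)
  ... | r , ∣I∣+1+r≡∣g∣ =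
    let U' , I' , ∣U'∣ , ∣I'∣ , balanced = rebalance r U I (ℕ.m≤n⇒m≤1+n (ℕ.n≤1+n k)) ∣U∣ ∣I∣
    in  U' , I' , ∣U'∣ , ∣I'∣ , (begin
      hits (a ∷ as) g          ≡⟨ hits-∷ a as g ⟩
      hits as g + hits as g'   ≡⟨ hits-balanced as {g} {g'} {U} {I} (λ x → ∨-∧-balanced (g x) (g' x)) ⟩
      hits as U + hits as I    ≡⟨ hits-balanced as {U'} {I'} {U} {I} balanced ⟨
      hits as U' + hits as I'  ∎)
    where
    open ≡-Reasoning
    g' U I : Fin q → Bool
    g' x = g (a ⊕ x)
    U  x = g x ∨ g' x
    I  x = g x ∧ g' x
    ∣I∣ : size I + r ≡ k
    ∣I∣ = ℕ.suc-injective (trans (sym (ℕ.+-suc (size I) r)) (trans ∣I∣+1+r≡∣g∣ ∣g∣≡1+k))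
    ∣U∣ : size U ≡ r + suc (suc k)
    ∣U∣ = ℕ.+-cancelʳ-≡ (size I) (size U) (r + suc (suc k)) (begin
      size U + size I                    ≡⟨ size-balanced (λ x → ∨-∧-balanced (g x) (g' x)) ⟨
      size g + size g'                   ≡⟨ cong (_+_ (size g)) (size-translate g a) ⟩
      size g + size g                    ≡⟨ cong₂ _+_ (sym ∣I∣+1+r≡∣g∣) ∣g∣≡1+k ⟩
      (size I + suc r) + suc k           ≡⟨ lemma (size I) r k ⟩
      (r + suc (suc k)) + size I         ∎)
      where
      lemma : ∀ i r k → (i + suc r) + suc k ≡ (r + suc (suc k)) + i
      lemma = solve-∀

  hits-bound : ∀ {n} (as : Vec (Fin q) n) → Units as → ∀ k → k ≤ q → (g : Fin q → Bool) → size g ≡ k →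
               hits as g ≤ bound q n k
  hits-bound {n} as _ zero _ g ∣g∣≡0 =
    subst (_≤ bound q n 0) (sym (count-none (λ ε → size≡0⇒empty g ∣g∣≡0 (sumModq q as ε)) (allChoices n))) z≤n
  hits-bound {n} as units (suc k) 1+k≤q g ∣g∣≡1+k with ℕ.m≤n⇒m<n∨m≡n 1+k≤q
  ... | inj₂ 1+k≡q = subst (λ m → hits as g ≤ bound q n m) (sym 1+k≡q)
                           (subst (hits as g ≤_) (sym (bound-full n)) (count-≤-length _ (allChoices n)))
  hits-bound [] _ (suc k) 1+k≤q g _ | inj₁ _ =
    ℕ.≤-trans (ℕ.≤-trans (ℕ.≤-reflexive (ℕ.+-identityʳ _)) (𝟙≤1 _)) (bound-positive (suc k) (s≤s z≤n) 1+k≤q)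
  hits-bound {suc n} (a ∷ as) units (suc k) 1+k≤q g ∣g∣≡1+k | inj₁ 1+k<q =
    let U' , I' , ∣U'∣ , ∣I'∣ , split = hits-∷-rebalanced a as (units zero) g ∣g∣≡1+k 1+k<q
    in  begin
      hits (a ∷ as) g                          ≡⟨ split ⟩
      hits as U' + hits as I'                  ≤⟨ ℕ.+-mono-≤ (hits-bound as (units ∘ suc) (suc (suc k)) 1+k<q U' ∣U'∣)
                                                              (hits-bound as (units ∘ suc) k k≤q I' ∣I'∣) ⟩
      bound q n (suc (suc k)) + bound q n k    ≡⟨ bound-pascal n k ⟨
      bound q (suc n) (suc k)                  ∎
    where
    open ℕ.≤-Reasoning
    k≤q = ℕ.<⇒≤ (ℕ.<-trans (ℕ.n<1+n k) 1+k<q)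

1-mod-coprime : ∀ q .{{_ : NonZero q}} → Coprime (toℕ (1 mod q)) q
1-mod-coprime (suc zero)    = Coprimality.sym (Coprimality.1-coprimeTo 0)
1-mod-coprime (suc (suc q)) = Coprimality.1-coprimeTo (suc (suc q))

theorem1 : (q n k : ℕ) .{{_ : NonZero q}} → 1 ≤ k → k ≤ q →
    ((a : Vec (Fin q) n) → (∀ i → Coprime (toℕ (lookup a i)) q) →
    (P : Subset q) → ∣ P ∣ ≡ k → hitCount q a P ≤ bound q n k)
    × Σ (Vec (Fin q) n) (λ a → (∀ i → Coprime (toℕ (lookup a i)) q) ×
    Σ (Subset q) (λ P → ∣ P ∣ ≡ k × hitCount q a P ≡ bound q n k))
theorem1 q n k _ k≤q = upper-bound , ones n , ones-units , tabulate extremal , ∣extremal∣ , extremal-attains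
  where
  open SubsetSums q
  open ModBinomial q
  open Arcs q
  open Bound q
  open UpperBound q
  open Window using (windowStart)
  upper-bound : (a : Vec (Fin q) n) → Units a → (P : Subset q) → ∣ P ∣ ≡ k → hitCount q a P ≤ bound q n k
  upper-bound a units P ∣P∣≡k = subst (_≤ bound q n k) (sym (hitCount≡hits a P))
                                  (hits-bound a units k k≤q (lookup P) (trans (sym (card-lookup P)) ∣P∣≡k))
  ones-units : Units (ones n)
  ones-units i = subst (λ x → Coprime (toℕ x) q) (sym (lookup-replicate i one)) (1-mod-coprime q)
  extremal : Fin q → Bool
  extremal = arc (windowStart n k) k
  ∣extremal∣ : ∣ tabulate extremal ∣ ≡ k
  ∣extremal∣ = trans (card-lookup (tabulate extremal)) (trans (size-cong (lookup∘tabulate extremal)) (size-arc (windowStart n k) k k≤q))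
  extremal-attains : hitCount q (ones n) (tabulate extremal) ≡ bound q n k
  extremal-attains = trans (hitCount≡hits (ones n) (tabulate extremal))
                           (trans (count-cong (lookup∘tabulate extremal ∘ sumModq q (ones n)) (allChoices n)) (bound-attained n k k≤q))
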